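{- Let $G$ be the graph with vertex set $\mathbb{Z}^2$ in which two vertices are adjacent iff their Euclidean distance is $1$ (the graph of the periodic tiling of the plane by unit squares). Define $w:E\to\{1,2,3\}$ by $w(e)=2$ if $e$ has an endpoint both of whose coordinates are odd, and $w(e)=1$ otherwise (equivalently: the plane is cut into the $2\times 2$ blocks $[2a,2a+2]\times[2b,2b+2]$, edges on block boundaries get weight $1$ and the four edges inside each block get weight $2$). Then $w$ is a solution to the 1-2-3 problem for $G$, i.e. $s_w(u)\neq s_w(v)$ for every edge $uv$.
   Context: For a graph $G=(V,E)$ and $w:E\to\{1,2,3\}$, the weighted degree of $u\in V$ is $s_w(u)=\sum_{uv\in E}w(uv)$; $w$ is a solution to the 1-2-3 problem if adjacent vertices have different weighted degrees. -}

module Defs where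

open import Data.Nat using (ℕ)
open import Data.Nat as ℕ using ()
open import Data.Bool using (Bool; true; false; _∧_; _∨_; if_then_else_)
open import Data.Integer using (ℤ; _+_; _-_; ∣_∣; +_; -[1+_])
open import Data.Product using (_×_; _,_)
open import Data.List using (List; _∷_; []; map)
open import Data.Nat.ListAction using (sum)
open import Relation.Binary.PropositionalEquality using (_≡_)
open import Data.Sum using (_⊎_)

Vertex : Set
Vertex = ℤ × ℤ

sqDist : Vertex → Vertex → ℕ
sqDist (x₁ , y₁) (x₂ , y₂) = ∣ x₁ - x₂ ∣ ℕ.* ∣ x₁ - x₂ ∣ ℕ.+ ∣ y₁ - y₂ ∣ ℕ.* ∣ y₁ - y₂ ∣

Adjacent : Vertex → Vertex → Set
Adjacent u v = sqDist u v ≡ 1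

oddℕ : ℕ → Bool
oddℕ ℕ.zero = false
oddℕ (ℕ.suc n) = notB (oddℕ n)
  where
  notB : Bool → Bool
  notB true = false
  notB false = true

oddℤ : ℤ → Bool
oddℤ x = oddℕ ∣ x ∣

bothOdd : Vertex → Bool
bothOdd (x , y) = oddℤ x ∧ oddℤ y

-- The edge weighting w : w(uv) = 2 if u or v has both coordinates odd, else 1.
-- (Symmetric in u and v, so it is a function on undirected edges.)
w : Vertex → Vertex → ℕ
w u v = if bothOdd u ∨ bothOdd v then 2 else 1

neighbours : Vertex → List Vertex
neighbours (x , y) =
  (x + + 1 , y) ∷ (x - + 1 , y) ∷ (x , y + + 1) ∷ (x , y - + 1) ∷ []

s : Vertex → ℕ
s u = sum (map (w u) (neighbours u))

-- A horizontal edge joins vertices whose x-coordinates have opposite parity,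
-- so it has weight 2 exactly when its y-coordinate is odd; symmetrically for
-- vertical edges.  Hence s (x , y) = 2 (weight (x odd) + weight (y odd)) with
-- weight b = 2 if b else 1, i.e. s only sees the two parities.  Along an edge
-- one coordinate moves by ±1, flipping its parity, while the other is fixed,
-- so the weighted degree changes by ±2.
module Submission where

open import Defs
open import Data.Bool using (Bool; true; false; not; _∧_; _∨_; if_then_else_)
open import Data.Bool.Properties using (not-involutive)
open import Data.Integer as ℤ using (+_; -[1+_]; ∣_∣; -_)
import Data.Integer.Properties as ℤ
import Data.Integer.Tactic.RingSolver as ℤ-Solver
open import Data.Nat as ℕ using (ℕ; zero; suc; _*_)
open import Data.Nat.Properties using (+-comm; m*n≡1⇒m≡1)
import Data.Nat.Tactic.RingSolver as ℕ-Solver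
open import Data.Product using (_×_; _,_)
open import Data.Sum using (_⊎_; inj₁; inj₂)
open import Relation.Binary.PropositionalEquality
  using (_≡_; _≢_; refl; sym; trans; cong; cong₂; module ≡-Reasoning)
open ≡-Reasoning

oddℕ-suc : ∀ n → oddℕ (suc n) ≡ not (oddℕ n)
oddℕ-suc n with oddℕ n
... | true  = refl
... | false = refl

oddℤ-suc : ∀ i → oddℤ (i ℤ.+ + 1) ≡ not (oddℤ i)
oddℤ-suc (+ n)        = trans (cong oddℕ (+-comm n 1)) (oddℕ-suc n)
oddℤ-suc -[1+ zero ]  = refl
oddℤ-suc -[1+ suc n ] =
  sym (trans (cong not (oddℕ-suc (suc n))) (not-involutive (oddℕ (suc n))))

oddℤ-neg : ∀ i → oddℤ (- i) ≡ oddℤ i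
oddℤ-neg i = cong oddℕ (ℤ.∣-i∣≡∣i∣ i)

oddℤ-pred : ∀ i → oddℤ (i ℤ.- + 1) ≡ not (oddℤ i)
oddℤ-pred i = begin
  oddℤ (i ℤ.- + 1)           ≡⟨ cong oddℤ (i-1≡-[-i+1] i) ⟩
  oddℤ (- (- i ℤ.+ + 1))     ≡⟨ oddℤ-neg (- i ℤ.+ + 1) ⟩
  oddℤ (- i ℤ.+ + 1)         ≡⟨ oddℤ-suc (- i) ⟩
  not (oddℤ (- i))           ≡⟨ cong not (oddℤ-neg i) ⟩
  not (oddℤ i)               ∎
  where
  i-1≡-[-i+1] : ∀ i → i ℤ.- + 1 ≡ - (- i ℤ.+ + 1)
  i-1≡-[-i+1] = ℤ-Solver.solve-∀

oddℤ-+-unit : ∀ i d → ∣ d ∣ ≡ 1 → oddℤ (i ℤ.+ d) ≡ not (oddℤ i)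
oddℤ-+-unit i (+ 1)           _  = oddℤ-suc i
oddℤ-+-unit i -[1+ 0 ]        _  = oddℤ-pred i
oddℤ-+-unit i (+ 0)           ()
oddℤ-+-unit i (+ suc (suc n)) ()
oddℤ-+-unit i -[1+ suc n ]    ()

oddℤ-∣-∣≡1 : ∀ i j → ∣ i ℤ.- j ∣ ≡ 1 → oddℤ i ≡ not (oddℤ j)
oddℤ-∣-∣≡1 i j ∣i-j∣≡1 = begin
  oddℤ i                     ≡⟨ cong oddℤ (i≡j+[i-j] i j) ⟩
  oddℤ (j ℤ.+ (i ℤ.- j))     ≡⟨ oddℤ-+-unit j (i ℤ.- j) ∣i-j∣≡1 ⟩
  not (oddℤ j)               ∎
  where
  i≡j+[i-j] : ∀ i j → i ≡ j ℤ.+ (i ℤ.- j)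
  i≡j+[i-j] = ℤ-Solver.solve-∀

oddℤ-∣-∣≡0 : ∀ i j → ∣ i ℤ.- j ∣ ≡ 0 → oddℤ i ≡ oddℤ j
oddℤ-∣-∣≡0 i j ∣i-j∣≡0 = cong oddℤ (ℤ.i-j≡0⇒i≡j i j (ℤ.∣i∣≡0⇒i≡0 ∣i-j∣≡0))

m*m+n*n≡1 : ∀ m n → m * m ℕ.+ n * n ≡ 1 → (m ≡ 1 × n ≡ 0) ⊎ (m ≡ 0 × n ≡ 1)
m*m+n*n≡1 zero          n       eq = inj₂ (refl , m*n≡1⇒m≡1 n n eq)
m*m+n*n≡1 (suc zero)    zero    _  = inj₁ (refl , refl)
m*m+n*n≡1 (suc zero)    (suc n) ()
m*m+n*n≡1 (suc (suc m)) n       ()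

weight : Bool → ℕ
weight b = if b then 2 else 1

degree : Bool → Bool → ℕ
degree p q = 2 * (weight p ℕ.+ weight q)

w-along-x : ∀ x x′ y → oddℤ x′ ≡ not (oddℤ x) → w (x , y) (x′ , y) ≡ weight (oddℤ y)
w-along-x x x′ y x′-flips = cong weight (begin
  (oddℤ x ∧ oddℤ y) ∨ (oddℤ x′ ∧ oddℤ y)      ≡⟨ cong (λ b → (oddℤ x ∧ oddℤ y) ∨ (b ∧ oddℤ y)) x′-flips ⟩
  (oddℤ x ∧ oddℤ y) ∨ (not (oddℤ x) ∧ oddℤ y) ≡⟨ ∧-∨-complementˡ (oddℤ x) (oddℤ y) ⟩
  oddℤ y                                      ∎)
  where
  ∧-∨-complementˡ : ∀ p q → (p ∧ q) ∨ (not p ∧ q) ≡ q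
  ∧-∨-complementˡ true  true  = refl
  ∧-∨-complementˡ true  false = refl
  ∧-∨-complementˡ false q     = refl

w-along-y : ∀ x y y′ → oddℤ y′ ≡ not (oddℤ y) → w (x , y) (x , y′) ≡ weight (oddℤ x)
w-along-y x y y′ y′-flips = cong weight (begin
  (oddℤ x ∧ oddℤ y) ∨ (oddℤ x ∧ oddℤ y′)      ≡⟨ cong (λ b → (oddℤ x ∧ oddℤ y) ∨ (oddℤ x ∧ b)) y′-flips ⟩
  (oddℤ x ∧ oddℤ y) ∨ (oddℤ x ∧ not (oddℤ y)) ≡⟨ ∧-∨-complementʳ (oddℤ x) (oddℤ y) ⟩
  oddℤ x                                      ∎)
  where
  ∧-∨-complementʳ : ∀ p q → (p ∧ q) ∨ (p ∧ not q) ≡ p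
  ∧-∨-complementʳ true  true  = refl
  ∧-∨-complementʳ true  false = refl
  ∧-∨-complementʳ false q     = refl

s≡degree : ∀ x y → s (x , y) ≡ degree (oddℤ x) (oddℤ y)
s≡degree x y = begin
  s (x , y)
    ≡⟨⟩
  w (x , y) (x ℤ.+ + 1 , y) ℕ.+ (w (x , y) (x ℤ.- + 1 , y) ℕ.+
    (w (x , y) (x , y ℤ.+ + 1) ℕ.+ (w (x , y) (x , y ℤ.- + 1) ℕ.+ 0)))
    ≡⟨ cong₂ ℕ._+_ (w-along-x x (x ℤ.+ + 1) y (oddℤ-suc x))
         (cong₂ ℕ._+_ (w-along-x x (x ℤ.- + 1) y (oddℤ-pred x))
           (cong₂ ℕ._+_ (w-along-y x y (y ℤ.+ + 1) (oddℤ-suc y))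
             (cong (ℕ._+ 0) (w-along-y x y (y ℤ.- + 1) (oddℤ-pred y))))) ⟩
  weight (oddℤ y) ℕ.+ (weight (oddℤ y) ℕ.+ (weight (oddℤ x) ℕ.+ (weight (oddℤ x) ℕ.+ 0)))
    ≡⟨ b+[b+[a+[a+0]]]≡2*[a+b] (weight (oddℤ x)) (weight (oddℤ y)) ⟩
  degree (oddℤ x) (oddℤ y)
    ∎
  where
  b+[b+[a+[a+0]]]≡2*[a+b] : ∀ a b → b ℕ.+ (b ℕ.+ (a ℕ.+ (a ℕ.+ 0))) ≡ 2 * (a ℕ.+ b)
  b+[b+[a+[a+0]]]≡2*[a+b] = ℕ-Solver.solve-∀

degree-flipˡ : ∀ {p p′ q q′} → p ≡ not p′ → q ≡ q′ → degree p q ≢ degree p′ q′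
degree-flipˡ {p′ = true}  {q′ = true}  refl refl ()
degree-flipˡ {p′ = true}  {q′ = false} refl refl ()
degree-flipˡ {p′ = false} {q′ = true}  refl refl ()
degree-flipˡ {p′ = false} {q′ = false} refl refl ()

degree-flipʳ : ∀ {p p′ q q′} → p ≡ p′ → q ≡ not q′ → degree p q ≢ degree p′ q′
degree-flipʳ {p′ = true}  {q′ = true}  refl refl ()
degree-flipʳ {p′ = true}  {q′ = false} refl refl ()
degree-flipʳ {p′ = false} {q′ = true}  refl refl ()
degree-flipʳ {p′ = false} {q′ = false} refl refl ()

proposition3p3 : (u v : Vertex) → Adjacent u v → s u ≢ s v
proposition3p3 (x₁ , y₁) (x₂ , y₂) adj s≡s
  with m*m+n*n≡1 _ _ adj | trans (sym (s≡degree x₁ y₁)) (trans s≡s (s≡degree x₂ y₂))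
... | inj₁ (∣Δx∣≡1 , ∣Δy∣≡0) | degrees≡ =
  degree-flipˡ (oddℤ-∣-∣≡1 x₁ x₂ ∣Δx∣≡1) (oddℤ-∣-∣≡0 y₁ y₂ ∣Δy∣≡0) degrees≡
... | inj₂ (∣Δx∣≡0 , ∣Δy∣≡1) | degrees≡ =
  degree-flipʳ (oddℤ-∣-∣≡0 x₁ x₂ ∣Δx∣≡0) (oddℤ-∣-∣≡1 y₁ y₂ ∣Δy∣≡1) degrees≡
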